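{- Let $p$ be a prime, $K$ a field of characteristic $p$, $n\geq2$ an integer, $r=n-1$, and $f\in K^\times$. Let $A=K[t]/(t^{p^n})$ with the Hopf algebra structure given by $\Delta(t)=t\otimes1+1\otimes t+f\sum_{\ell=1}^{p-1}\frac{1}{\ell!(p-\ell)!}t^{p^{r}\ell}\otimes t^{p^{r}(p-\ell)}$, $\varepsilon(t)=0$, $\lambda(t)=-t$, let $H=\operatorname{Hom}_K(A,K)$ be its dual Hopf algebra, and for $0\le j\le p^n-1$ let $z_j\in H$ be defined by $z_j(t^i)=\delta_{i,j}$. Let $L=K(x)$ be a field extension of degree $p^n$ with $x^{p^n}\in K$, and let $\alpha:L\to L\otimes_K A$ be the $K$-algebra homomorphism with \[ \alpha(x)=x\otimes1+1\otimes t+f\sum_{\ell=1}^{p-1}\frac{1}{\ell!(p-\ell)!}x^{p^{r}\ell}\otimes t^{p^{r}(p-\ell)}. \] Let $H$ act on $L$ by $h(y)=\operatorname{mult}(1\otimes h)\alpha(y)$. Then for $1\leq m\leq r$ we have $z_{0}(x^{p^{m}})=x^{p^{m}}$ and $z_{p^{m}}(x^{p^{m}})=1$, and $z_{j}(x^{p^{m}})=0$ for every $0\le j\le p^n-1$ with $j\notin\{0,p^m\}$.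
   Context: $\delta_{i,j}$ is the Kronecker delta. The coefficients $1/(\ell!(p-\ell)!)$ are interpreted in $\mathbb{F}_p\subseteq K$. The dual $H$ has multiplication $(\phi\psi)(h)=\operatorname{mult}(\phi\otimes\psi)\Delta(h)$. -}

module Defs where

open import Level using (Level; _⊔_)
open import Algebra.Bundles using (CommutativeRing)
open import Data.Nat using (ℕ; zero; suc)
import Data.Nat as ℕ
open import Data.Nat using (_!)
open import Data.Fin using (Fin; toℕ)
open import Relation.Nullary using (¬_; yes; no)
open import Relation.Binary.PropositionalEquality using (_≡_)
open import Data.Product using (∃)

record Field c ℓ : Set (Level.suc (c ⊔ ℓ)) where
  field
    commutativeRing : CommutativeRing c ℓ
  open CommutativeRing commutativeRing public
  field
    _⁻¹     : Carrier → Carrier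
    0≉1     : ¬ (0# ≈ 1#)
    inverse : ∀ x → ¬ (x ≈ 0#) → x * (x ⁻¹) ≈ 1#

module FieldOps {c ℓ} (K : Field c ℓ) where
  open Field K

  natK : ℕ → Carrier
  natK zero    = 0#
  natK (suc k) = 1# + natK k

  -- K has characteristic p (for p prime this means char K = p exactly)
  HasChar : ℕ → Set ℓ
  HasChar q = natK q ≈ 0#

  ∑ : (k : ℕ) → (Fin k → Carrier) → Carrier
  ∑ zero    g = 0#
  ∑ (suc k) g = g Fin.zero + ∑ k (λ i → g (Fin.suc i))
    where import Data.Fin as Fin

  δ : ℕ → ℕ → Carrier
  δ i j with i ℕ.≟ j
  ... | yes _ = 1#
  ... | no  _ = 0#

  -- Fix N = p^n and a = x^N ∈ K.
  -- L = K(x) is represented by coordinates w.r.t. the K-basis 1, x, …, x^(N-1)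
  -- (i.e. L = K[X]/(X^N - a)); A = K[t]/(t^N) by coordinates w.r.t. 1,…,t^(N-1);
  -- L ⊗_K A by coordinates w.r.t. x^i ⊗ t^j; H = Hom_K(A,K) by the values
  -- h(t^j) on the basis of A.

  L : ℕ → Set c
  L N = Fin N → Carrier

  LA : ℕ → Set c
  LA N = Fin N → Fin N → Carrier

  H : ℕ → Set c
  H N = Fin N → Carrier

  -- coefficient of x^i in x^s, for s < 2N (x^N = a)
  Xc : (N : ℕ) → Carrier → ℕ → ℕ → Carrier
  Xc N a s i = δ s i + a * δ s (i ℕ.+ N)

  oneL : (N : ℕ) → L N
  oneL N i = δ (toℕ i) 0

  xL : (N : ℕ) → L N
  xL N i = δ (toℕ i) 1

  mulL : (N : ℕ) → Carrier → L N → L N → L N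
  mulL N a u v i = ∑ N (λ b → ∑ N (λ d → (u b * v d) * Xc N a (toℕ b ℕ.+ toℕ d) (toℕ i)))

  powL : (N : ℕ) → Carrier → L N → ℕ → L N
  powL N a u zero    = oneL N
  powL N a u (suc k) = mulL N a u (powL N a u k)

  -- L = K[X]/(X^N - a) is a field (so K(x) has degree N over K, x^N = a)
  IsFieldL : (N : ℕ) → Carrier → Set (c ⊔ ℓ)
  IsFieldL N a = ∀ (y : L N) → ¬ (∀ i → y i ≈ 0#) →
                 ∃ λ (w : L N) → ∀ i → mulL N a y w i ≈ oneL N i

  oneLA : (N : ℕ) → LA N
  oneLA N i j = δ (toℕ i) 0 * δ (toℕ j) 0

  mulLA : (N : ℕ) → Carrier → LA N → LA N → LA N
  mulLA N a u v i j =
    ∑ N (λ b → ∑ N (λ e → ∑ N (λ d → ∑ N (λ g →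
      ((u b e * v d g) * Xc N a (toℕ b ℕ.+ toℕ d) (toℕ i)) * δ (toℕ e ℕ.+ toℕ g) (toℕ j)))))

  powLA : (N : ℕ) → Carrier → LA N → ℕ → LA N
  powLA N a u zero    = oneLA N
  powLA N a u (suc k) = mulLA N a u (powLA N a u k)

  coef : ℕ → ℕ → Carrier
  coef p l = natK ((l !) ℕ.* ((p ℕ.∸ l) !)) ⁻¹

  αx : (p n : ℕ) → Carrier → LA (p ℕ.^ n)
  αx p n f i j =
    (δ (toℕ i) 1 * δ (toℕ j) 0 + δ (toℕ i) 0 * δ (toℕ j) 1)
    + f * ∑ (p ℕ.∸ 1) (λ l′ →
        (coef p (suc (toℕ l′)) * δ (toℕ i) (p ℕ.^ (n ℕ.∸ 1) ℕ.* suc (toℕ l′)))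
          * δ (toℕ j) (p ℕ.^ (n ℕ.∸ 1) ℕ.* (p ℕ.∸ suc (toℕ l′))))

  α : (p n : ℕ) → Carrier → Carrier → L (p ℕ.^ n) → LA (p ℕ.^ n)
  α p n a f y i j = ∑ (p ℕ.^ n) (λ k → y k * powLA (p ℕ.^ n) a (αx p n f) (toℕ k) i j)

  act : (p n : ℕ) → Carrier → Carrier → H (p ℕ.^ n) → L (p ℕ.^ n) → L (p ℕ.^ n)
  act p n a f h y i = ∑ (p ℕ.^ n) (λ j → α p n a f y i j * h j)

  z : (N : ℕ) → ℕ → H N
  z N j i = δ (toℕ i) j

module Submission where

-- Put N = p^n. L ⊗ A is the commutative ring K[X,T]/(X^N − a, T^N), and α(x) = X + T + Q where
-- every term of Q is divisible by T^(p^r). As p^m < N, x^(p^m) is a basis vector of L, so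
-- α(x^(p^m)) = α(x)^(p^m), and in characteristic p the p^m-th power map is additive:
-- α(x)^(p^m) = X^(p^m) + T^(p^m) + Q^(p^m). Already Q^p is divisible by T^(p·p^r) = T^N, so
-- α(x^(p^m)) = x^(p^m) ⊗ 1 + 1 ⊗ t^(p^m), and z_j reads off the coefficient of t^j.

open import Defs
open import Algebra.Bundles using (CommutativeSemiring)
open import Algebra.Structures using (IsCommutativeSemiring)
open import Data.Empty using (⊥-elim)
open import Data.Fin as Fin using (Fin; toℕ; fromℕ<)
import Data.Fin.Properties as Finₚ
open import Data.Nat as ℕ using (ℕ; zero; suc; _≤_; _<_; _∸_; z≤n; s≤s; _!)
import Data.Nat.Properties as ℕₚ
open import Data.Nat.Combinatorics using (_C_; nCn≡1; nCk≡nC[n∸k]; nCk≡n!/k![n-k]!; k![n∸k]!∣n!)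
open import Data.Nat.Divisibility using (_∣_; divides; ∣⇒≤; m∣m*n)
open import Data.Nat.DivMod using (m/n*n≡m)
open import Data.Nat.Primality using (Prime; prime⇒nonTrivial; euclidsLemma)
open import Data.Product using (_,_)
open import Data.Sum using (inj₁; inj₂)
open import Function using (_∘_)
open import Relation.Binary.Structures using (IsEquivalence)
open import Relation.Nullary using (¬_; yes; no)
open import Relation.Binary.PropositionalEquality as ≡ using (_≡_; _≢_)

module PrimeBinomial where

  prime⇒1<p : ∀ {p} → Prime p → 1 < p
  prime⇒1<p {p} pp = ℕ.nonTrivial⇒n>1 p {{prime⇒nonTrivial pp}}

  prime∤! : ∀ {p} → Prime p → ∀ j → j < p → ¬ p ∣ j !
  prime∤! pp zero j<p p∣1 = ℕₚ.<⇒≱ (prime⇒1<p pp) (∣⇒≤ p∣1)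
  prime∤! pp (suc j) j<p p∣j! with euclidsLemma (suc j) (j !) pp p∣j!
  ... | inj₁ p∣1+j = ℕₚ.<⇒≱ j<p (∣⇒≤ p∣1+j)
  ... | inj₂ p∣j!  = prime∤! pp j (ℕₚ.<-trans (ℕₚ.n<1+n j) j<p) p∣j!

  prime∣! : ∀ {p} → Prime p → p ∣ p !
  prime∣! {suc q} _ = m∣m*n (q !)

  -- p divides (p C k) * k! (p−k)! = p! but neither factorial.
  prime∣C : ∀ {p} → Prime p → ∀ k → 0 < k → k < p → p ∣ p C k
  prime∣C {p} pp k 0<k k<p with euclidsLemma (p C k) (k ! ℕ.* (p ∸ k) !) pp p∣C*k![p∸k]!
    where
    instance _ = k ℕₚ.!* (p ∸ k) !≢0
    p∣C*k![p∸k]! : p ∣ (p C k) ℕ.* (k ! ℕ.* (p ∸ k) !)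
    p∣C*k![p∸k]! = ≡.subst (p ∣_) (≡.sym C*k![p∸k]!≡p!) (prime∣! pp)
      where
      C*k![p∸k]!≡p! : (p C k) ℕ.* (k ! ℕ.* (p ∸ k) !) ≡ p !
      C*k![p∸k]!≡p! = ≡.trans (≡.cong (ℕ._* (k ! ℕ.* (p ∸ k) !)) (nCk≡n!/k![n-k]! (ℕₚ.<⇒≤ k<p)))
                              (m/n*n≡m (k![n∸k]!∣n! (ℕₚ.<⇒≤ k<p)))
  ... | inj₁ p∣C = p∣C
  ... | inj₂ p∣k![p∸k]! with euclidsLemma (k !) ((p ∸ k) !) pp p∣k![p∸k]!
  ...   | inj₁ p∣k!     = ⊥-elim (prime∤! pp k k<p p∣k!)
  ...   | inj₂ p∣[p∸k]! = ⊥-elim (prime∤! pp (p ∸ k) (ℕₚ.∸-monoʳ-< 0<k (ℕₚ.<⇒≤ k<p)) p∣[p∸k]!)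

module Frobenius {a ℓ} (R : CommutativeSemiring a ℓ) where
  open CommutativeSemiring R
  open import Algebra.Properties.CommutativeSemiring.Binomial R
  open import Algebra.Properties.Semiring.Exp semiring using (_^_; ^-assocʳ; ^-congˡ)
  open import Algebra.Properties.Semiring.Mult semiring using (_×_)
  open import Algebra.Properties.Semiring.Sum semiring using (sum; sum-init-last; sum-cong-≋; sum-replicate-zero)
  open import Relation.Binary.Reasoning.Setoid setoid

  binomialExpansion≈x^n+y^n : ∀ q → (∀ k z → 0 < k → k < suc q → (suc q C k) × z ≈ 0#) →
                              ∀ x y → binomialExpansion x y (suc q) ≈ x ^ suc q + y ^ suc q
  binomialExpansion≈x^n+y^n q C×≈0 x y = begin
    term Fin.zero + sum (term ∘ Fin.suc)
      ≈⟨ +-congˡ (sum-init-last (term ∘ Fin.suc)) ⟩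
    term Fin.zero + (sum (term ∘ Fin.suc ∘ Fin.inject₁) + term (Fin.suc (Fin.fromℕ q)))
      ≈⟨ +-cong first (+-cong (trans (sum-cong-≋ middle) (sum-replicate-zero q)) last) ⟩
    y ^ suc q + (0# + x ^ suc q)
      ≈⟨ trans (+-congˡ (+-identityˡ _)) (+-comm _ _) ⟩
    x ^ suc q + y ^ suc q ∎
    where
    term = binomialTerm x y (suc q)
    first : term Fin.zero ≈ y ^ suc q
    first = begin
      (suc q C 0) × (1# * y ^ suc q)
        ≡⟨ ≡.cong (_× (1# * y ^ suc q)) (≡.trans (nCk≡nC[n∸k] {0} {suc q} z≤n) (nCn≡1 (suc q))) ⟩
      1# * y ^ suc q + 0#            ≈⟨ trans (+-identityʳ _) (*-identityˡ _) ⟩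
      y ^ suc q                      ∎
    middle : ∀ j → term (Fin.suc (Fin.inject₁ j)) ≈ 0#
    middle j = C×≈0 _ _ (s≤s z≤n) (s≤s (≡.subst (_< q) (≡.sym (Finₚ.toℕ-inject₁ j)) (Finₚ.toℕ<n j)))
    last : term (Fin.suc (Fin.fromℕ q)) ≈ x ^ suc q
    last = begin
      term (Fin.suc (Fin.fromℕ q))  ≡⟨ ≡.cong (λ i → (suc q C suc i) × (x ^ suc i * y ^ (q ∸ i))) (Finₚ.toℕ-fromℕ q) ⟩
      (suc q C suc q) × (x ^ suc q * y ^ (q ∸ q))
        ≡⟨ ≡.cong₂ (λ c e → c × (x ^ suc q * y ^ e)) (nCn≡1 (suc q)) (ℕₚ.n∸n≡0 q) ⟩
      x ^ suc q * 1# + 0#          ≈⟨ trans (+-identityʳ _) (*-identityʳ _) ⟩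
      x ^ suc q                    ∎

  ^p-distrib-+ : ∀ {p} → Prime p → (∀ k z → p ∣ k → k × z ≈ 0#) → ∀ x y → (x + y) ^ p ≈ x ^ p + y ^ p
  ^p-distrib-+ {zero} p-prime _ = ⊥-elim (ℕₚ.<⇒≱ (PrimeBinomial.prime⇒1<p p-prime) z≤n)
  ^p-distrib-+ {suc q} p-prime char x y = trans (theorem (suc q) x y)
    (binomialExpansion≈x^n+y^n q (λ k z 0<k k<p → char _ z (PrimeBinomial.prime∣C p-prime k 0<k k<p)) x y)

  module _ {p} (p-prime : Prime p) (char : ∀ k z → p ∣ k → k × z ≈ 0#) where

    ^p^m-distrib-+ : ∀ m x y → (x + y) ^ (p ℕ.^ m) ≈ x ^ (p ℕ.^ m) + y ^ (p ℕ.^ m)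
    ^p^m-distrib-+ zero x y = trans (*-identityʳ _) (sym (+-cong (*-identityʳ _) (*-identityʳ _)))
    ^p^m-distrib-+ (suc m) x y = begin
      (x + y) ^ (p ℕ.* p ℕ.^ m)                   ≈⟨ ^-assocʳ _ p (p ℕ.^ m) ⟨
      ((x + y) ^ p) ^ (p ℕ.^ m)                   ≈⟨ ^-congˡ (p ℕ.^ m) (^p-distrib-+ p-prime char x y) ⟩
      (x ^ p + y ^ p) ^ (p ℕ.^ m)                 ≈⟨ ^p^m-distrib-+ m (x ^ p) (y ^ p) ⟩
      (x ^ p) ^ (p ℕ.^ m) + (y ^ p) ^ (p ℕ.^ m)   ≈⟨ +-cong (^-assocʳ x p _) (^-assocʳ y p _) ⟩
      x ^ (p ℕ.* p ℕ.^ m) + y ^ (p ℕ.* p ℕ.^ m)   ∎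

module StructureConstants {c ℓ} (R : CommutativeSemiring c ℓ) where
  open CommutativeSemiring R
  open import Algebra.Properties.CommutativeSemigroup *-commutativeSemigroup using (xy∙z≈xz∙y)
  open import Relation.Binary.Reasoning.Setoid setoid

  module Summation {I : Set} (S : (I → Carrier) → Carrier)
    (S-cong  : ∀ {f g : I → Carrier} → (∀ i → f i ≈ g i) → S f ≈ S g)
    (S-+     : ∀ (f g : I → Carrier) → S (λ i → f i + g i) ≈ S f + S g)
    (S-*ˡ    : ∀ x (f : I → Carrier) → x * S f ≈ S (λ i → x * f i))
    (S-swap  : ∀ (f : I → I → Carrier) → S (λ i → S (λ j → f i j)) ≈ S (λ j → S (λ i → f i j)))
    where

    S-zero : ∀ {f : I → Carrier} → (∀ i → f i ≈ 0#) → S f ≈ 0#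
    S-zero {f} f≈0 = begin
      S f                   ≈⟨ S-cong (λ i → trans (f≈0 i) (sym (zeroˡ 0#))) ⟩
      S (λ _ → 0# * 0#)     ≈⟨ S-*ˡ 0# (λ _ → 0#) ⟨
      0# * S (λ _ → 0#)     ≈⟨ zeroˡ _ ⟩
      0#                    ∎

    S-*ʳ : ∀ x f → S f * x ≈ S (λ i → f i * x)
    S-*ʳ x f = trans (*-comm _ _) (trans (S-*ˡ x f) (S-cong (λ i → *-comm _ _)))

    -- The algebra with basis I and multiplication e_b e_d = S_i C b d i e_i.
    module Algebra
      (C : I → I → I → Carrier)
      (C-comm  : ∀ b d i → C b d i ≈ C d b i)
      (C-assoc : ∀ b d e i → S (λ s → C b d s * C s e i) ≈ S (λ s → C d e s * C b s i))
      (unit : I → Carrier)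
      (unit-identity : ∀ (v : I → Carrier) i → S (λ b → S (λ d → (unit b * v d) * C b d i)) ≈ v i)
      where

      El : Set c
      El = I → Carrier

      infix 4 _≋_
      infixl 6 _⊕_
      infixl 7 _⊛_

      _≋_ : El → El → Set ℓ
      u ≋ v = ∀ i → u i ≈ v i

      _⊕_ : El → El → El
      (u ⊕ v) i = u i + v i

      _⊛_ : El → El → El
      (u ⊛ v) i = S (λ b → S (λ d → (u b * v d) * C b d i))

      𝟘 : El
      𝟘 _ = 0#

      ⊛-comm : ∀ u v → u ⊛ v ≋ v ⊛ u
      ⊛-comm u v i = trans (S-swap _) (S-cong (λ b → S-cong (λ d → *-cong (*-comm _ _) (C-comm d b i))))

      ⊛-cong : ∀ {u u′ v v′} → u ≋ u′ → v ≋ v′ → u ⊛ v ≋ u′ ⊛ v′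
      ⊛-cong u≋u′ v≋v′ i = S-cong (λ b → S-cong (λ d → *-congʳ (*-cong (u≋u′ b) (v≋v′ d))))

      ⊛-zeroˡ : ∀ v → 𝟘 ⊛ v ≋ 𝟘
      ⊛-zeroˡ v i = S-zero (λ b → S-zero (λ d → trans (*-congʳ (zeroˡ _)) (zeroˡ _)))

      ⊛-distribˡ : ∀ u v w → u ⊛ (v ⊕ w) ≋ u ⊛ v ⊕ u ⊛ w
      ⊛-distribˡ u v w i = begin
        S (λ b → S (λ d → (u b * (v d + w d)) * C b d i))
          ≈⟨ S-cong (λ b → S-cong (λ d → trans (*-congʳ (distribˡ _ _ _)) (distribʳ _ _ _))) ⟩
        S (λ b → S (λ d → (u b * v d) * C b d i + (u b * w d) * C b d i))
          ≈⟨ S-cong (λ b → S-+ _ _) ⟩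
        S (λ b → S (λ d → (u b * v d) * C b d i) + S (λ d → (u b * w d) * C b d i))
          ≈⟨ S-+ _ _ ⟩
        (u ⊛ v) i + (u ⊛ w) i ∎

      ⊛-assoc : ∀ u v w → (u ⊛ v) ⊛ w ≋ u ⊛ (v ⊛ w)
      ⊛-assoc u v w i = begin
        S (λ s → S (λ e → (S (λ b → S (λ d → (u b * v d) * C b d s)) * w e) * C s e i))
          ≈⟨ S-cong (λ s → S-cong (λ e → pull-outʳ)) ⟩
        S (λ s → S (λ e → S (λ b → S (λ d → (((u b * v d) * C b d s) * w e) * C s e i))))
          ≈⟨ S-cong (λ s → S-cong (λ e → S-cong (λ b → S-cong (λ d → regroupˡ))) ) ⟩
        S (λ s → S (λ e → S (λ b → S (λ d → uvw b d e * (C b d s * C s e i)))))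
          ≈⟨ trans (S-swap _) (trans (S-cong (λ e → S-swap _)) (S-cong (λ e → S-cong (λ b → S-swap _)))) ⟩
        S (λ e → S (λ b → S (λ d → S (λ s → uvw b d e * (C b d s * C s e i)))))
          ≈⟨ trans (S-swap _) (S-cong (λ b → S-swap _)) ⟩
        S (λ b → S (λ d → S (λ e → S (λ s → uvw b d e * (C b d s * C s e i)))))
          ≈⟨ S-cong (λ b → S-cong (λ d → S-cong (λ e → by-C-assoc b d e))) ⟩
        S (λ b → S (λ d → S (λ e → S (λ s → uvw b d e * (C d e s * C b s i)))))
          ≈⟨ S-cong (λ b → trans (S-cong (λ d → S-swap _)) (S-swap _)) ⟩
        S (λ b → S (λ s → S (λ d → S (λ e → uvw b d e * (C d e s * C b s i)))))
          ≈⟨ S-cong (λ b → S-cong (λ s → S-cong (λ d → S-cong (λ e → regroupʳ)))) ⟩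
        S (λ b → S (λ s → S (λ d → S (λ e → (u b * ((v d * w e) * C d e s)) * C b s i))))
          ≈⟨ S-cong (λ b → S-cong (λ s → pull-outˡ)) ⟨
        S (λ b → S (λ s → (u b * S (λ d → S (λ e → (v d * w e) * C d e s))) * C b s i)) ∎
        where
        uvw : I → I → I → Carrier
        uvw b d e = (u b * v d) * w e
        pull-outʳ : ∀ {f : I → I → Carrier} {x y} → (S (λ b → S (f b)) * x) * y ≈ S (λ b → S (λ d → (f b d * x) * y))
        pull-outʳ = trans (*-congʳ (trans (S-*ʳ _ _) (S-cong (λ b → S-*ʳ _ _)))) (trans (S-*ʳ _ _) (S-cong (λ b → S-*ʳ _ _)))
        pull-outˡ : ∀ {f : I → I → Carrier} {x y} → (x * S (λ d → S (f d))) * y ≈ S (λ d → S (λ e → (x * f d e) * y))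
        pull-outˡ = trans (*-congʳ (trans (S-*ˡ _ _) (S-cong (λ d → S-*ˡ _ _)))) (trans (S-*ʳ _ _) (S-cong (λ d → S-*ʳ _ _)))
        regroupˡ : ∀ {x c₁ y c₂} → ((x * c₁) * y) * c₂ ≈ (x * y) * (c₁ * c₂)
        regroupˡ = trans (*-congʳ (xy∙z≈xz∙y _ _ _)) (*-assoc _ _ _)
        regroupʳ : ∀ {x y z c₁ c₂} → ((x * y) * z) * (c₁ * c₂) ≈ (x * ((y * z) * c₁)) * c₂
        regroupʳ = sym (trans (*-congʳ (trans (sym (*-assoc _ _ _)) (*-congʳ (sym (*-assoc _ _ _))))) (*-assoc _ _ _))
        by-C-assoc : ∀ b d e → S (λ s → uvw b d e * (C b d s * C s e i)) ≈ S (λ s → uvw b d e * (C d e s * C b s i))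
        by-C-assoc b d e = trans (sym (S-*ˡ _ _)) (trans (*-congˡ (C-assoc b d e i)) (S-*ˡ _ _))

      ≋-isEquivalence : IsEquivalence _≋_
      ≋-isEquivalence = record
        { refl = λ _ → refl ; sym = λ u≋v i → sym (u≋v i) ; trans = λ u≋v v≋w i → trans (u≋v i) (v≋w i) }

      ⊛-isCommutativeSemiring : IsCommutativeSemiring _≋_ _⊕_ _⊛_ 𝟘 unit
      ⊛-isCommutativeSemiring = record
        { isSemiring = record
          { isSemiringWithoutAnnihilatingZero = record
            { +-isCommutativeMonoid = record
              { isMonoid = record
                { isSemigroup = record
                  { isMagma = record
                    { isEquivalence = ≋-isEquivalence ; ∙-cong = λ u≋u′ v≋v′ i → +-cong (u≋u′ i) (v≋v′ i) }
                  ; assoc = λ _ _ _ _ → +-assoc _ _ _ }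
                ; identity = (λ _ _ → +-identityˡ _) , (λ _ _ → +-identityʳ _) }
              ; comm = λ _ _ _ → +-comm _ _ }
            ; *-cong = ⊛-cong
            ; *-assoc = ⊛-assoc
            ; *-identity = unit-identity , (λ v i → trans (⊛-comm v unit i) (unit-identity v i))
            ; distrib = ⊛-distribˡ
              , (λ u v w i → trans (⊛-comm (v ⊕ w) u i) (trans (⊛-distribˡ u v w i) (+-cong (⊛-comm u v i) (⊛-comm u w i)))) }
          ; zero = ⊛-zeroˡ , (λ v i → trans (⊛-comm v 𝟘 i) (⊛-zeroˡ v i)) }
        ; *-comm = ⊛-comm }

      ⊛-commutativeSemiring : CommutativeSemiring c ℓ
      ⊛-commutativeSemiring = record { isCommutativeSemiring = ⊛-isCommutativeSemiring }

      point⊛ : ∀ u b₀ v i → (∀ F → S (λ b → u b * F b) ≈ F b₀) → (u ⊛ v) i ≈ S (λ d → v d * C b₀ d i)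
      point⊛ u b₀ v i u-point = begin
        S (λ b → S (λ d → (u b * v d) * C b d i))  ≈⟨ S-cong (λ b → trans (S-cong (λ d → *-assoc _ _ _)) (sym (S-*ˡ _ _))) ⟩
        S (λ b → u b * S (λ d → v d * C b d i))    ≈⟨ u-point (λ b → S (λ d → v d * C b d i)) ⟩
        S (λ d → v d * C b₀ d i)                   ∎

module FieldLemmas {c ℓ} (K : Field c ℓ) where
  open Field K
  open FieldOps K
  open import Algebra.Properties.Semiring.Sum semiring
    using (sum; sum-cong-≋; sum-replicate-zero; ∑-distrib-+; ∑-comm; *-distribˡ-sum; *-distribʳ-sum)
  open import Relation.Binary.Reasoning.Setoid setoid

  ∑≡sum : ∀ k (g : Fin k → Carrier) → ∑ k g ≡ sum g
  ∑≡sum zero    g = ≡.refl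
  ∑≡sum (suc k) g = ≡.cong (g Fin.zero +_) (∑≡sum k (g ∘ Fin.suc))

  ∑-cong : ∀ k {g h : Fin k → Carrier} → (∀ i → g i ≈ h i) → ∑ k g ≈ ∑ k h
  ∑-cong k {g} {h} g≈h rewrite ∑≡sum k g | ∑≡sum k h = sum-cong-≋ g≈h

  ∑-+ : ∀ k (g h : Fin k → Carrier) → ∑ k (λ i → g i + h i) ≈ ∑ k g + ∑ k h
  ∑-+ k g h rewrite ∑≡sum k (λ i → g i + h i) | ∑≡sum k g | ∑≡sum k h = ∑-distrib-+ g h

  ∑-*ˡ : ∀ k x (g : Fin k → Carrier) → x * ∑ k g ≈ ∑ k (λ i → x * g i)
  ∑-*ˡ k x g rewrite ∑≡sum k g | ∑≡sum k (λ i → x * g i) = *-distribˡ-sum x g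

  ∑-*ʳ : ∀ k x (g : Fin k → Carrier) → ∑ k g * x ≈ ∑ k (λ i → g i * x)
  ∑-*ʳ k x g rewrite ∑≡sum k g | ∑≡sum k (λ i → g i * x) = *-distribʳ-sum x g

  ∑-swap : ∀ k l (g : Fin k → Fin l → Carrier) → ∑ k (λ i → ∑ l (g i)) ≈ ∑ l (λ j → ∑ k (λ i → g i j))
  ∑-swap k l g = begin
    ∑ k (λ i → ∑ l (g i))            ≈⟨ ∑-cong k (λ i → reflexive (∑≡sum l (g i))) ⟩
    ∑ k (λ i → sum (g i))            ≡⟨ ∑≡sum k _ ⟩
    sum (λ i → sum (g i))            ≈⟨ ∑-comm g ⟩
    sum (λ j → sum (λ i → g i j))    ≡⟨ ∑≡sum l _ ⟨
    ∑ l (λ j → sum (λ i → g i j))    ≈⟨ ∑-cong l (λ j → reflexive (∑≡sum k (λ i → g i j))) ⟨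
    ∑ l (λ j → ∑ k (λ i → g i j))    ∎

  ∑-zero : ∀ k {g : Fin k → Carrier} → (∀ i → g i ≈ 0#) → ∑ k g ≈ 0#
  ∑-zero k g≈0 = trans (∑-cong k g≈0) (trans (reflexive (∑≡sum k _)) (sum-replicate-zero k))

  δ-≡ : ∀ i j → i ≡ j → δ i j ≈ 1#
  δ-≡ i j i≡j with i ℕ.≟ j
  ... | yes _  = refl
  ... | no i≢j = ⊥-elim (i≢j i≡j)

  δ-≢ : ∀ i j → i ≢ j → δ i j ≈ 0#
  δ-≢ i j i≢j with i ℕ.≟ j
  ... | yes i≡j = ⊥-elim (i≢j i≡j)
  ... | no _    = refl

  δ-cong : ∀ i j i′ j′ → (i ≡ j → i′ ≡ j′) → (i′ ≡ j′ → i ≡ j) → δ i j ≈ δ i′ j′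
  δ-cong i j i′ j′ ⇒ ⇐ with i ℕ.≟ j
  ... | yes i≡j = sym (δ-≡ i′ j′ (⇒ i≡j))
  ... | no i≢j  = sym (δ-≢ i′ j′ (i≢j ∘ ⇐))

  δ-sym : ∀ i j → δ i j ≈ δ j i
  δ-sym i j = δ-cong i j j i ≡.sym ≡.sym

  ∑-δ : ∀ k q (q<k : q < k) (g : Fin k → Carrier) → ∑ k (λ i → δ (toℕ i) q * g i) ≈ g (fromℕ< q<k)
  ∑-δ (suc k) zero q<k g = begin
    δ 0 0 * g Fin.zero + ∑ k (λ i → δ (suc (toℕ i)) 0 * g (Fin.suc i))
      ≈⟨ +-cong (trans (*-congʳ (δ-≡ 0 0 ≡.refl)) (*-identityˡ _))
                (∑-zero k (λ i → trans (*-congʳ (δ-≢ (suc (toℕ i)) 0 λ ())) (zeroˡ _))) ⟩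
    g Fin.zero + 0#  ≈⟨ +-identityʳ _ ⟩
    g Fin.zero       ∎
  ∑-δ (suc k) (suc q) q<k g = begin
    δ 0 (suc q) * g Fin.zero + ∑ k (λ i → δ (suc (toℕ i)) (suc q) * g (Fin.suc i))
      ≈⟨ +-cong (trans (*-congʳ (δ-≢ 0 (suc q) λ ())) (zeroˡ _))
                (∑-cong k (λ i → *-congʳ (δ-cong (suc (toℕ i)) (suc q) (toℕ i) q ℕₚ.suc-injective (≡.cong suc)))) ⟩
    0# + ∑ k (λ i → δ (toℕ i) q * g (Fin.suc i))  ≈⟨ +-identityˡ _ ⟩
    ∑ k (λ i → δ (toℕ i) q * g (Fin.suc i))       ≈⟨ ∑-δ k q (ℕₚ.≤-pred q<k) (g ∘ Fin.suc) ⟩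
    g (Fin.suc (fromℕ< (ℕₚ.≤-pred q<k)))           ∎

  ∑-δ-≥ : ∀ k q → k ≤ q → (g : Fin k → Carrier) → ∑ k (λ i → δ (toℕ i) q * g i) ≈ 0#
  ∑-δ-≥ k q k≤q g = ∑-zero k (λ i → trans (*-congʳ (δ-≢ (toℕ i) q (i≢q i))) (zeroˡ _))
    where
    i≢q : ∀ i → toℕ i ≢ q
    i≢q i = ℕₚ.<⇒≢ (ℕₚ.<-≤-trans (Finₚ.toℕ<n i) k≤q)

  natK-+ : ∀ m n → natK (m ℕ.+ n) ≈ natK m + natK n
  natK-+ zero    n = sym (+-identityˡ _)
  natK-+ (suc m) n = trans (+-congˡ (natK-+ m n)) (sym (+-assoc _ _ _))

  natK-* : ∀ m n → natK (m ℕ.* n) ≈ natK m * natK n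
  natK-* zero    n = sym (zeroˡ _)
  natK-* (suc m) n = begin
    natK (n ℕ.+ m ℕ.* n)             ≈⟨ natK-+ n (m ℕ.* n) ⟩
    natK n + natK (m ℕ.* n)          ≈⟨ +-cong (sym (*-identityˡ _)) (natK-* m n) ⟩
    1# * natK n + natK m * natK n    ≈⟨ distribʳ _ _ _ ⟨
    (1# + natK m) * natK n           ∎

  natK-∣ : ∀ {p k} → HasChar p → p ∣ k → natK k ≈ 0#
  natK-∣ {p} char (divides q ≡.refl) = trans (natK-* q p) (trans (*-congˡ char) (zeroʳ _))

module Reduction {c ℓ} (K : Field c ℓ) (N : ℕ) (a : Field.Carrier K) where
  open Field K
  open FieldOps K
  open FieldLemmas K
  open import Relation.Binary.Reasoning.Setoid setoid

  Xc-< : ∀ q i → q < N → Xc N a q i ≈ δ q i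
  Xc-< q i q<N = begin
    δ q i + a * δ q (i ℕ.+ N)
      ≈⟨ +-congˡ (*-congˡ (δ-≢ q (i ℕ.+ N) (ℕₚ.<⇒≢ (ℕₚ.<-≤-trans q<N (ℕₚ.m≤n+m N i))))) ⟩
    δ q i + a * 0#             ≈⟨ trans (+-congˡ (zeroʳ a)) (+-identityʳ _) ⟩
    δ q i                      ∎

  Xc-≥ : ∀ q i → N ≤ q → i < N → Xc N a q i ≈ a * δ (q ∸ N) i
  Xc-≥ q i N≤q i<N = begin
    δ q i + a * δ q (i ℕ.+ N)  ≈⟨ +-cong (δ-≢ q i (ℕₚ.<⇒≢ (ℕₚ.<-≤-trans i<N N≤q) ∘ ≡.sym)) (*-congˡ shift) ⟩
    0# + a * δ (q ∸ N) i       ≈⟨ +-identityˡ _ ⟩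
    a * δ (q ∸ N) i            ∎
    where
    shift : δ q (i ℕ.+ N) ≈ δ (q ∸ N) i
    shift = δ-cong q (i ℕ.+ N) (q ∸ N) i
      (λ q≡i+N → ≡.trans (≡.cong (_∸ N) q≡i+N) (ℕₚ.m+n∸n≡m i N))
      (λ q∸N≡i → ≡.trans (≡.sym (ℕₚ.m∸n+n≡m N≤q)) (≡.cong (ℕ._+ N) q∸N≡i))

  -- The coefficient of x^i in x^t for t < 3N, i < N.
  Xc₃ : ℕ → ℕ → Carrier
  Xc₃ t i with N ℕ.≤? t
  ... | yes _ = a * Xc N a (t ∸ N) i
  ... | no  _ = Xc N a t i

  Xc₃-< : ∀ t i → t < N ℕ.+ N → i < N → Xc N a t i ≈ Xc₃ t i
  Xc₃-< t i t<2N i<N with N ℕ.≤? t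
  ... | no  _   = refl
  ... | yes N≤t = trans (Xc-≥ t i N≤t i<N) (*-congˡ (sym (Xc-< (t ∸ N) i t∸N<N)))
    where t∸N<N = ℕₚ.+-cancelʳ-< _ _ _ (≡.subst (_< N ℕ.+ N) (≡.sym (ℕₚ.m∸n+n≡m N≤t)) t<2N)

  Xc₃-≥ : ∀ t i → N ≤ t → Xc₃ t i ≈ a * Xc N a (t ∸ N) i
  Xc₃-≥ t i N≤t with N ℕ.≤? t
  ... | yes _  = refl
  ... | no N≰t = ⊥-elim (N≰t N≤t)

  ∑Xc*Xc≈Xc₃ : ∀ q e i → q < N ℕ.+ N → e < N → i < N →
               ∑ N (λ s → Xc N a q (toℕ s) * Xc N a (toℕ s ℕ.+ e) i) ≈ Xc₃ (q ℕ.+ e) i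
  ∑Xc*Xc≈Xc₃ q e i q<2N e<N i<N = begin
    ∑ N (λ s → Xc N a q (toℕ s) * G s)
      ≈⟨ ∑-cong N (λ s → trans (distribʳ _ _ _) (+-cong (*-congʳ (δ-sym q (toℕ s))) (*-assoc _ _ _))) ⟩
    ∑ N (λ s → δ (toℕ s) q * G s + a * (δ q (toℕ s ℕ.+ N) * G s))
      ≈⟨ trans (∑-+ N _ _) (+-congˡ (sym (∑-*ˡ N a _))) ⟩
    ∑ N (λ s → δ (toℕ s) q * G s) + a * ∑ N (λ s → δ q (toℕ s ℕ.+ N) * G s)
      ≈⟨ by-cases ⟩
    Xc₃ (q ℕ.+ e) i ∎
    where
    G : Fin N → Carrier
    G s = Xc N a (toℕ s ℕ.+ e) i
    G-fromℕ< : ∀ {t} (t<N : t < N) → G (fromℕ< t<N) ≡ Xc N a (t ℕ.+ e) i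
    G-fromℕ< t<N = ≡.cong (λ t → Xc N a (t ℕ.+ e) i) (Finₚ.toℕ-fromℕ< t<N)
    by-cases : ∑ N (λ s → δ (toℕ s) q * G s) + a * ∑ N (λ s → δ q (toℕ s ℕ.+ N) * G s) ≈ Xc₃ (q ℕ.+ e) i
    by-cases with q ℕ.<? N
    ... | yes q<N = begin
      _                       ≈⟨ +-cong (∑-δ N q q<N G) (*-congˡ (∑-zero N (λ s → trans (*-congʳ (high s)) (zeroˡ _)))) ⟩
      G (fromℕ< q<N) + a * 0#  ≈⟨ trans (+-congˡ (zeroʳ a)) (+-identityʳ _) ⟩
      G (fromℕ< q<N)           ≡⟨ G-fromℕ< q<N ⟩
      Xc N a (q ℕ.+ e) i       ≈⟨ Xc₃-< (q ℕ.+ e) i (ℕₚ.+-mono-< q<N e<N) i<N ⟩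
      Xc₃ (q ℕ.+ e) i          ∎
      where
      high : ∀ s → δ q (toℕ s ℕ.+ N) ≈ 0#
      high s = δ-≢ q (toℕ s ℕ.+ N) (ℕₚ.<⇒≢ (ℕₚ.<-≤-trans q<N (ℕₚ.m≤n+m N (toℕ s))))
    ... | no q≮N = begin
      _                                           ≈⟨ +-cong (∑-δ-≥ N q N≤q G) (*-congˡ (∑-cong N (λ s → *-congʳ (shift s)))) ⟩
      0# + a * ∑ N (λ s → δ (toℕ s) (q ∸ N) * G s)  ≈⟨ trans (+-identityˡ _) (*-congˡ (∑-δ N (q ∸ N) q∸N<N G)) ⟩
      a * G (fromℕ< q∸N<N)                        ≡⟨ ≡.cong (a *_) (G-fromℕ< q∸N<N) ⟩
      a * Xc N a (q ∸ N ℕ.+ e) i                  ≡⟨ ≡.cong (λ t → a * Xc N a t i) (ℕₚ.+-∸-comm e N≤q) ⟨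
      a * Xc N a (q ℕ.+ e ∸ N) i                  ≈⟨ Xc₃-≥ (q ℕ.+ e) i (ℕₚ.≤-trans N≤q (ℕₚ.m≤m+n q e)) ⟨
      Xc₃ (q ℕ.+ e) i                             ∎
      where
      N≤q : N ≤ q
      N≤q = ℕₚ.≮⇒≥ q≮N
      q∸N<N : q ∸ N < N
      q∸N<N = ℕₚ.+-cancelʳ-< _ _ _ (≡.subst (_< N ℕ.+ N) (≡.sym (ℕₚ.m∸n+n≡m N≤q)) q<2N)
      shift : ∀ s → δ q (toℕ s ℕ.+ N) ≈ δ (toℕ s) (q ∸ N)
      shift s = δ-cong q (toℕ s ℕ.+ N) (toℕ s) (q ∸ N)
        (λ q≡s+N → ≡.sym (≡.trans (≡.cong (_∸ N) q≡s+N) (ℕₚ.m+n∸n≡m (toℕ s) N)))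
        (λ s≡q∸N → ≡.trans (≡.sym (ℕₚ.m∸n+n≡m N≤q)) (≡.cong (ℕ._+ N) (≡.sym s≡q∸N)))

  -- Both sides are the coefficient of x^i in x^(b+d+e).
  Xc-assoc : ∀ (b d e i : Fin N) →
             ∑ N (λ s → Xc N a (toℕ b ℕ.+ toℕ d) (toℕ s) * Xc N a (toℕ s ℕ.+ toℕ e) (toℕ i))
             ≈ ∑ N (λ s → Xc N a (toℕ d ℕ.+ toℕ e) (toℕ s) * Xc N a (toℕ b ℕ.+ toℕ s) (toℕ i))
  Xc-assoc b d e i = begin
    _  ≈⟨ ∑Xc*Xc≈Xc₃ (toℕ b ℕ.+ toℕ d) (toℕ e) (toℕ i) (<N+N b d) (Finₚ.toℕ<n e) (Finₚ.toℕ<n i) ⟩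
    Xc₃ (toℕ b ℕ.+ toℕ d ℕ.+ toℕ e) (toℕ i)
       ≡⟨ ≡.cong (λ t → Xc₃ t (toℕ i)) (≡.trans (ℕₚ.+-assoc (toℕ b) _ _) (ℕₚ.+-comm (toℕ b) _)) ⟩
    Xc₃ (toℕ d ℕ.+ toℕ e ℕ.+ toℕ b) (toℕ i)
       ≈⟨ ∑Xc*Xc≈Xc₃ (toℕ d ℕ.+ toℕ e) (toℕ b) (toℕ i) (<N+N d e) (Finₚ.toℕ<n b) (Finₚ.toℕ<n i) ⟨
    ∑ N (λ s → Xc N a (toℕ d ℕ.+ toℕ e) (toℕ s) * Xc N a (toℕ s ℕ.+ toℕ b) (toℕ i))
       ≈⟨ ∑-cong N (λ s → *-congˡ (reflexive (≡.cong (λ t → Xc N a t (toℕ i)) (ℕₚ.+-comm (toℕ s) (toℕ b))))) ⟩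
    _  ∎
    where
    <N+N : ∀ (u v : Fin N) → toℕ u ℕ.+ toℕ v < N ℕ.+ N
    <N+N u v = ℕₚ.+-mono-< (Finₚ.toℕ<n u) (Finₚ.toℕ<n v)

  x^ : ∀ k → k < N → ∀ i → powL N a (xL N) k i ≈ δ (toℕ i) k
  x^ zero    _   i = refl
  x^ (suc k) k<N i = begin
    ∑ N (λ b → ∑ N (λ d → (xL N b * powL N a (xL N) k d) * Xc N a (toℕ b ℕ.+ toℕ d) (toℕ i)))
      ≈⟨ ∑-cong N (λ b → trans (∑-cong N (λ d → trans (*-congʳ (*-congˡ (x^ k k′<N d))) (*-assoc _ _ _)))
                               (sym (∑-*ˡ N _ _))) ⟩
    ∑ N (λ b → δ (toℕ b) 1 * ∑ N (λ d → δ (toℕ d) k * Xc N a (toℕ b ℕ.+ toℕ d) (toℕ i)))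
      ≈⟨ ∑-cong N (λ b → *-congˡ (∑-δ N k k′<N _)) ⟩
    ∑ N (λ b → δ (toℕ b) 1 * Xc N a (toℕ b ℕ.+ toℕ (fromℕ< k′<N)) (toℕ i))
      ≈⟨ ∑-δ N 1 1<N _ ⟩
    Xc N a (toℕ (fromℕ< 1<N) ℕ.+ toℕ (fromℕ< k′<N)) (toℕ i)
      ≡⟨ ≡.cong₂ (λ x y → Xc N a (x ℕ.+ y) (toℕ i)) (Finₚ.toℕ-fromℕ< 1<N) (Finₚ.toℕ-fromℕ< k′<N) ⟩
    Xc N a (suc k) (toℕ i)
      ≈⟨ trans (Xc-< (suc k) (toℕ i) k<N) (δ-sym (suc k) (toℕ i)) ⟩
    δ (toℕ i) (suc k) ∎
    where
    k′<N = ℕₚ.<-trans (ℕₚ.n<1+n k) k<N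
    1<N  = ℕₚ.≤-trans (s≤s (s≤s z≤n)) k<N

module TensorProduct {c ℓ} (K : Field c ℓ) (N : ℕ) (a : Field.Carrier K) (N>0 : 0 < N) where
  open Field K
  open FieldOps K
  open FieldLemmas K
  open import Algebra.Properties.CommutativeSemigroup *-commutativeSemigroup using (interchange)
  import Data.Product as Product
  open import Relation.Binary.Reasoning.Setoid setoid

  I : Set
  I = Fin N Product.× Fin N

  S : (I → Carrier) → Carrier
  S g = ∑ N (λ b → ∑ N (λ e → g (b , e)))

  S-cong : ∀ {g h : I → Carrier} → (∀ i → g i ≈ h i) → S g ≈ S h
  S-cong g≈h = ∑-cong N (λ b → ∑-cong N (λ e → g≈h (b , e)))

  S-+ : ∀ g h → S (λ i → g i + h i) ≈ S g + S h
  S-+ g h = trans (∑-cong N (λ b → ∑-+ N _ _)) (∑-+ N _ _)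

  S-*ˡ : ∀ x g → x * S g ≈ S (λ i → x * g i)
  S-*ˡ x g = trans (∑-*ˡ N x _) (∑-cong N (λ b → ∑-*ˡ N x _))

  S-swap : ∀ (g : I → I → Carrier) → S (λ i → S (λ j → g i j)) ≈ S (λ j → S (λ i → g i j))
  S-swap g = begin
    ∑ N (λ b → ∑ N (λ e → ∑ N (λ d → ∑ N (λ h → g (b , e) (d , h)))))
      ≈⟨ ∑-cong N (λ b → ∑-swap N N _) ⟩
    ∑ N (λ b → ∑ N (λ d → ∑ N (λ e → ∑ N (λ h → g (b , e) (d , h)))))
      ≈⟨ ∑-swap N N _ ⟩
    ∑ N (λ d → ∑ N (λ b → ∑ N (λ e → ∑ N (λ h → g (b , e) (d , h)))))
      ≈⟨ ∑-cong N (λ d → ∑-cong N (λ b → ∑-swap N N _)) ⟩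
    ∑ N (λ d → ∑ N (λ b → ∑ N (λ h → ∑ N (λ e → g (b , e) (d , h)))))
      ≈⟨ ∑-cong N (λ d → ∑-swap N N _) ⟩
    ∑ N (λ d → ∑ N (λ h → ∑ N (λ b → ∑ N (λ e → g (b , e) (d , h))))) ∎

  S-separate : ∀ (A A′ B B′ : Fin N → Carrier) →
               S (λ (s , h) → (A s * B h) * (A′ s * B′ h)) ≈ ∑ N (λ s → A s * A′ s) * ∑ N (λ h → B h * B′ h)
  S-separate A A′ B B′ = begin
    ∑ N (λ s → ∑ N (λ h → (A s * B h) * (A′ s * B′ h)))
      ≈⟨ ∑-cong N (λ s → trans (∑-cong N (λ h → interchange _ _ _ _)) (sym (∑-*ˡ N _ _))) ⟩
    ∑ N (λ s → (A s * A′ s) * ∑ N (λ h → B h * B′ h))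
      ≈⟨ ∑-*ʳ N _ _ ⟨
    ∑ N (λ s → A s * A′ s) * ∑ N (λ h → B h * B′ h) ∎

  Mon : ℕ → ℕ → I → Carrier
  Mon s t (i , j) = δ (toℕ i) s * δ (toℕ j) t

  S-Mon : ∀ s t (s<N : s < N) (t<N : t < N) (g : I → Carrier) → S (λ i → Mon s t i * g i) ≈ g (fromℕ< s<N , fromℕ< t<N)
  S-Mon s t s<N t<N g = begin
    ∑ N (λ b → ∑ N (λ e → (δ (toℕ b) s * δ (toℕ e) t) * g (b , e)))
      ≈⟨ ∑-cong N (λ b → trans (∑-cong N (λ e → *-assoc _ _ _)) (sym (∑-*ˡ N _ _))) ⟩
    ∑ N (λ b → δ (toℕ b) s * ∑ N (λ e → δ (toℕ e) t * g (b , e)))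
      ≈⟨ ∑-cong N (λ b → *-congˡ (∑-δ N t t<N (λ e → g (b , e)))) ⟩
    ∑ N (λ b → δ (toℕ b) s * g (b , fromℕ< t<N))
      ≈⟨ ∑-δ N s s<N _ ⟩
    g (fromℕ< s<N , fromℕ< t<N) ∎

  S-Mon-toℕ : ∀ (i j : Fin N) (g : I → Carrier) → S (λ ij → Mon (toℕ i) (toℕ j) ij * g ij) ≈ g (i , j)
  S-Mon-toℕ i j g = trans (S-Mon (toℕ i) (toℕ j) (Finₚ.toℕ<n i) (Finₚ.toℕ<n j) g)
    (reflexive (≡.cong₂ (λ x y → g (x , y)) (Finₚ.fromℕ<-toℕ i (Finₚ.toℕ<n i)) (Finₚ.fromℕ<-toℕ j (Finₚ.toℕ<n j))))

  C : I → I → I → Carrier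
  C (b , e) (d , h) (i , j) = Xc N a (toℕ b ℕ.+ toℕ d) (toℕ i) * δ (toℕ e ℕ.+ toℕ h) (toℕ j)

  C-comm : ∀ b d i → C b d i ≈ C d b i
  C-comm (b , e) (d , h) (i , j) =
    reflexive (≡.cong₂ (λ x y → Xc N a x (toℕ i) * δ y (toℕ j)) (ℕₚ.+-comm (toℕ b) _) (ℕₚ.+-comm (toℕ e) _))

  -- δ is the structure constant of K[T]/(T^N), i.e. Xc with a = 0.
  δ-assoc : ∀ (b d e i : Fin N) →
            ∑ N (λ s → δ (toℕ b ℕ.+ toℕ d) (toℕ s) * δ (toℕ s ℕ.+ toℕ e) (toℕ i))
            ≈ ∑ N (λ s → δ (toℕ d ℕ.+ toℕ e) (toℕ s) * δ (toℕ b ℕ.+ toℕ s) (toℕ i))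
  δ-assoc b d e i = begin
    _  ≈⟨ ∑-cong N (λ s → *-cong (δ≈Xc₀ (toℕ b ℕ.+ toℕ d) (toℕ s)) (δ≈Xc₀ (toℕ s ℕ.+ toℕ e) (toℕ i))) ⟩
    _  ≈⟨ Reduction.Xc-assoc K N 0# b d e i ⟩
    _  ≈⟨ ∑-cong N (λ s → *-cong (δ≈Xc₀ (toℕ d ℕ.+ toℕ e) (toℕ s)) (δ≈Xc₀ (toℕ b ℕ.+ toℕ s) (toℕ i))) ⟨
    _  ∎
    where
    δ≈Xc₀ : ∀ x y → δ x y ≈ Xc N 0# x y
    δ≈Xc₀ x y = sym (trans (+-congˡ (zeroˡ _)) (+-identityʳ _))

  C-assoc : ∀ b d e i → S (λ s → C b d s * C s e i) ≈ S (λ s → C d e s * C b s i)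
  C-assoc (b , b′) (d , d′) (e , e′) (i , i′) = begin
    _  ≈⟨ S-separate _ _ _ _ ⟩
    _  ≈⟨ *-cong (Reduction.Xc-assoc K N a b d e i) (δ-assoc b′ d′ e′ i′) ⟩
    _  ≈⟨ S-separate _ _ _ _ ⟨
    _  ∎

  unit : I → Carrier
  unit = Mon 0 0

  unit-identity : ∀ v i → S (λ b → S (λ d → (unit b * v d) * C b d i)) ≈ v i
  unit-identity v (i , j) = begin
    S (λ b → S (λ d → (unit b * v d) * C b d (i , j)))
      ≈⟨ S-cong (λ b → trans (S-cong (λ d → *-assoc _ _ _)) (sym (S-*ˡ _ _))) ⟩
    S (λ b → unit b * S (λ d → v d * C b d (i , j)))
      ≈⟨ S-Mon 0 0 N>0 N>0 _ ⟩
    S (λ d → v d * C (0ᴺ , 0ᴺ) d (i , j))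
      ≈⟨ S-cong (λ d → trans (*-comm _ _) (*-congʳ (C-0 d))) ⟩
    S (λ d → Mon (toℕ i) (toℕ j) d * v d)
      ≈⟨ S-Mon-toℕ i j v ⟩
    v (i , j) ∎
    where
    0ᴺ : Fin N
    0ᴺ = fromℕ< N>0
    C-0 : ∀ d → C (0ᴺ , 0ᴺ) d (i , j) ≈ Mon (toℕ i) (toℕ j) d
    C-0 (d , h) = begin
      Xc N a (toℕ 0ᴺ ℕ.+ toℕ d) (toℕ i) * δ (toℕ 0ᴺ ℕ.+ toℕ h) (toℕ j)
        ≡⟨ ≡.cong (λ z → Xc N a (z ℕ.+ toℕ d) (toℕ i) * δ (z ℕ.+ toℕ h) (toℕ j)) (Finₚ.toℕ-fromℕ< N>0) ⟩
      Xc N a (toℕ d) (toℕ i) * δ (toℕ h) (toℕ j)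
        ≈⟨ *-congʳ (Reduction.Xc-< K N a (toℕ d) (toℕ i) (Finₚ.toℕ<n d)) ⟩
      Mon (toℕ i) (toℕ j) (d , h) ∎

  open StructureConstants commutativeSemiring
  open Summation S S-cong S-+ S-*ˡ S-swap public
  open Algebra C C-comm C-assoc unit unit-identity public
  open import Algebra.Properties.Semiring.Exp (CommutativeSemiring.semiring ⊛-commutativeSemiring) public
    using (_^_; ^-assocʳ; ^-congˡ)
  open import Algebra.Properties.Semiring.Mult (CommutativeSemiring.semiring ⊛-commutativeSemiring) public
    using (_×_)

  El⟨_⟩ : LA N → El
  El⟨ u ⟩ (i , j) = u i j

  powLA≈^ : ∀ u k i j → powLA N a u k i j ≈ (El⟨ u ⟩ ^ k) (i , j)
  powLA≈^ u zero    i j = refl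
  powLA≈^ u (suc k) i j = ∑-cong N (λ b → ∑-cong N (λ e → ∑-cong N (λ d → ∑-cong N (λ h →
    trans (*-assoc _ _ _) (*-congʳ (*-congˡ (powLA≈^ u k d h)))))))

  ×≈natK* : ∀ k u → k × u ≋ (λ i → natK k * u i)
  ×≈natK* zero    u i = sym (zeroˡ _)
  ×≈natK* (suc k) u i = trans (+-congˡ (×≈natK* k u i)) (trans (+-congʳ (sym (*-identityˡ _))) (sym (distribʳ _ _ _)))

  Mon⊛Mon : ∀ s t s′ t′ → s < N → t < N → s′ < N → t′ < N → s ℕ.+ s′ < N →
            Mon s t ⊛ Mon s′ t′ ≋ Mon (s ℕ.+ s′) (t ℕ.+ t′)
  Mon⊛Mon s t s′ t′ s<N t<N s′<N t′<N s+s′<N (i , j) = begin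
    (Mon s t ⊛ Mon s′ t′) (i , j)
      ≈⟨ point⊛ (Mon s t) (fromℕ< s<N , fromℕ< t<N) (Mon s′ t′) (i , j) (S-Mon s t s<N t<N) ⟩
    S (λ d → Mon s′ t′ d * C (fromℕ< s<N , fromℕ< t<N) d (i , j))
      ≈⟨ S-Mon s′ t′ s′<N t′<N _ ⟩
    Xc N a (toℕ (fromℕ< s<N) ℕ.+ toℕ (fromℕ< s′<N)) (toℕ i) * δ (toℕ (fromℕ< t<N) ℕ.+ toℕ (fromℕ< t′<N)) (toℕ j)
      ≡⟨ ≡.cong₂ (λ x y → Xc N a x (toℕ i) * δ y (toℕ j))
                 (≡.cong₂ ℕ._+_ (Finₚ.toℕ-fromℕ< s<N) (Finₚ.toℕ-fromℕ< s′<N))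
                 (≡.cong₂ ℕ._+_ (Finₚ.toℕ-fromℕ< t<N) (Finₚ.toℕ-fromℕ< t′<N)) ⟩
    Xc N a (s ℕ.+ s′) (toℕ i) * δ (t ℕ.+ t′) (toℕ j)
      ≈⟨ *-cong (trans (Reduction.Xc-< K N a _ _ s+s′<N) (δ-sym (s ℕ.+ s′) (toℕ i))) (δ-sym (t ℕ.+ t′) (toℕ j)) ⟩
    Mon (s ℕ.+ s′) (t ℕ.+ t′) (i , j) ∎

  X^ : ∀ k → k < N → Mon 1 0 ^ k ≋ Mon k 0
  X^ zero    _   _  = refl
  X^ (suc k) k<N ij = trans (⊛-cong (λ _ → refl) (X^ k k′<N) ij) (Mon⊛Mon 1 0 k 0 1<N N>0 k′<N N>0 k<N ij)
    where
    k′<N = ℕₚ.<-trans (ℕₚ.n<1+n k) k<N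
    1<N  = ℕₚ.≤-trans (s≤s (s≤s z≤n)) k<N

  T^ : ∀ k → k < N → Mon 0 1 ^ k ≋ Mon 0 k
  T^ zero    _   _  = refl
  T^ (suc k) k<N ij = trans (⊛-cong (λ _ → refl) (T^ k k′<N) ij) (Mon⊛Mon 0 1 0 k N>0 1<N N>0 k′<N N>0 ij)
    where
    k′<N = ℕₚ.<-trans (ℕₚ.n<1+n k) k<N
    1<N  = ℕₚ.≤-trans (s≤s (s≤s z≤n)) k<N

  T-order≥ : ℕ → El → Set ℓ
  T-order≥ d u = ∀ i j → toℕ j < d → u (i , j) ≈ 0#

  T-order≥-⊛ : ∀ d d′ u v → T-order≥ d u → T-order≥ d′ v → T-order≥ (d ℕ.+ d′) (u ⊛ v)
  T-order≥-⊛ d d′ u v ord-u ord-v i j j<d+d′ = S-zero (λ be → S-zero (λ dh → vanishes be dh))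
    where
    vanishes : ∀ be dh → (u be * v dh) * C be dh (i , j) ≈ 0#
    vanishes (b , e) (d₁ , h) with toℕ e ℕ.<? d | toℕ h ℕ.<? d′
    ... | yes e<d | _       = trans (*-congʳ (trans (*-congʳ (ord-u b e e<d)) (zeroˡ _))) (zeroˡ _)
    ... | no _    | yes h<d′ = trans (*-congʳ (trans (*-congˡ (ord-v d₁ h h<d′)) (zeroʳ _))) (zeroˡ _)
    ... | no e≮d  | no h≮d′  = trans (*-congˡ (trans (*-congˡ (δ-≢ _ _ e+h≢j)) (zeroʳ _))) (zeroʳ _)
      where
      e+h≢j : toℕ e ℕ.+ toℕ h ≢ toℕ j
      e+h≢j e+h≡j =
        ℕₚ.<⇒≱ j<d+d′ (≡.subst (d ℕ.+ d′ ≤_) e+h≡j (ℕₚ.+-mono-≤ (ℕₚ.≮⇒≥ e≮d) (ℕₚ.≮⇒≥ h≮d′)))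

  T-order≥-^ : ∀ d u → T-order≥ d u → ∀ k → T-order≥ (k ℕ.* d) (u ^ k)
  T-order≥-^ d u ord-u zero    i j ()
  T-order≥-^ d u ord-u (suc k) = T-order≥-⊛ d (k ℕ.* d) u (u ^ k) ord-u (T-order≥-^ d u ord-u k)

  T-order≥N⇒≋𝟘 : ∀ u → T-order≥ N u → u ≋ 𝟘
  T-order≥N⇒≋𝟘 u ord-u (i , j) = ord-u i j (Finₚ.toℕ<n j)

module Coaction {c ℓ} (K : Field c ℓ) {p} (p-prime : Prime p) (char : FieldOps.HasChar K p)
                (r : ℕ) (a f : Field.Carrier K) where
  open Field K
  open FieldOps K
  open FieldLemmas K
  open import Relation.Binary.Reasoning.Setoid setoid

  N : ℕ
  N = p ℕ.^ suc r

  1<p : 1 < p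
  1<p = PrimeBinomial.prime⇒1<p p-prime

  p^>0 : ∀ k → 0 < p ℕ.^ k
  p^>0 k = ℕₚ.m^n>0 p {{ℕ.>-nonZero (ℕₚ.<-trans (s≤s z≤n) 1<p)}} k

  open TensorProduct K N a (p^>0 (suc r))
  open Frobenius ⊛-commutativeSemiring using (^p^m-distrib-+)

  X T Q : El
  X = Mon 1 0
  T = Mon 0 1
  Q (i , j) = f * ∑ (p ∸ 1) (Q-term i j)
    where
    Q-term : Fin N → Fin N → Fin (p ∸ 1) → Carrier
    Q-term i j l′ = (coef p (suc (toℕ l′)) * δ (toℕ i) (p ℕ.^ r ℕ.* suc (toℕ l′)))
                    * δ (toℕ j) (p ℕ.^ r ℕ.* (p ∸ suc (toℕ l′)))

  α⟨x⟩≋X⊕T⊕Q : El⟨ αx p (suc r) f ⟩ ≋ X ⊕ T ⊕ Q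
  α⟨x⟩≋X⊕T⊕Q _ = refl

  Q-T-order : T-order≥ (p ℕ.^ r) Q
  Q-T-order i j j<p^r = trans (*-congˡ (∑-zero (p ∸ 1) (λ l′ → trans (*-congˡ (δ-≢ _ _ (j≢ l′))) (zeroʳ _)))) (zeroʳ f)
    where
    j≢ : ∀ (l′ : Fin (p ∸ 1)) → toℕ j ≢ p ℕ.^ r ℕ.* (p ∸ suc (toℕ l′))
    j≢ l′ j≡ = ℕₚ.<⇒≱ j<p^r (≡.subst (p ℕ.^ r ≤_) (≡.sym j≡) (ℕₚ.m≤m*n (p ℕ.^ r) _ {{ℕ.>-nonZero p∸l>0}}))
      where
      p∸l>0 : 0 < p ∸ suc (toℕ l′)
      p∸l>0 = ≡.subst (0 <_) (ℕₚ.∸-+-assoc p 1 (toℕ l′)) (ℕₚ.m<n⇒0<n∸m (Finₚ.toℕ<n l′))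

  ×-char : ∀ k u → p ∣ k → k × u ≋ 𝟘
  ×-char k u p∣k i = trans (×≈natK* k u i) (trans (*-congʳ (natK-∣ char p∣k)) (zeroˡ _))

  -- Q^p is divisible by T^(p·p^r) = T^N, hence vanishes.
  Q^p^m≋𝟘 : ∀ m → Q ^ (p ℕ.^ suc m) ≋ 𝟘
  Q^p^m≋𝟘 m ij = begin
    (Q ^ (p ℕ.* p ℕ.^ m)) ij   ≈⟨ ^-assocʳ Q p (p ℕ.^ m) ij ⟨
    ((Q ^ p) ^ (p ℕ.^ m)) ij   ≈⟨ ^-congˡ (p ℕ.^ m) (T-order≥N⇒≋𝟘 (Q ^ p) (T-order≥-^ (p ℕ.^ r) Q Q-T-order p)) ij ⟩
    (𝟘 ^ (p ℕ.^ m)) ij         ≈⟨ 𝟘^-pos (p ℕ.^ m) (p^>0 m) ij ⟩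
    0#                          ∎
    where
    𝟘^-pos : ∀ k → 0 < k → 𝟘 ^ k ≋ 𝟘
    𝟘^-pos (suc k) _ = ⊛-zeroˡ (𝟘 ^ k)

  α⟨x⟩^p^m : ∀ m → p ℕ.^ suc m < N →
             El⟨ αx p (suc r) f ⟩ ^ (p ℕ.^ suc m) ≋ Mon (p ℕ.^ suc m) 0 ⊕ Mon 0 (p ℕ.^ suc m)
  α⟨x⟩^p^m m q<N ij = begin
    (El⟨ αx p (suc r) f ⟩ ^ q) ij  ≈⟨ ^-congˡ q α⟨x⟩≋X⊕T⊕Q ij ⟩
    ((X ⊕ T ⊕ Q) ^ q) ij           ≈⟨ frob (suc m) (X ⊕ T) Q ij ⟩
    ((X ⊕ T) ^ q) ij + (Q ^ q) ij  ≈⟨ +-cong (frob (suc m) X T ij) (Q^p^m≋𝟘 m ij) ⟩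
    ((X ^ q) ij + (T ^ q) ij) + 0#  ≈⟨ trans (+-identityʳ _) (+-cong (X^ q q<N ij) (T^ q q<N ij)) ⟩
    Mon q 0 ij + Mon 0 q ij         ∎
    where
    q = p ℕ.^ suc m
    frob = ^p^m-distrib-+ p-prime ×-char

  module _ (m : ℕ) (q<N : p ℕ.^ suc m < N) where
    q : ℕ
    q = p ℕ.^ suc m

    x^q : L N
    x^q = powL N a (xL N) q

    α⟨x^q⟩ : ∀ i j → α p (suc r) a f x^q i j ≈ Mon q 0 (i , j) + Mon 0 q (i , j)
    α⟨x^q⟩ i j = begin
      ∑ N (λ k → x^q k * powLA N a (αx p (suc r) f) (toℕ k) i j)
        ≈⟨ ∑-cong N (λ k → *-congʳ (Reduction.x^ K N a q q<N k)) ⟩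
      ∑ N (λ k → δ (toℕ k) q * powLA N a (αx p (suc r) f) (toℕ k) i j)
        ≈⟨ ∑-δ N q q<N _ ⟩
      powLA N a (αx p (suc r) f) (toℕ (fromℕ< q<N)) i j
        ≡⟨ ≡.cong (λ k → powLA N a (αx p (suc r) f) k i j) (Finₚ.toℕ-fromℕ< q<N) ⟩
      powLA N a (αx p (suc r) f) q i j
        ≈⟨ trans (powLA≈^ (αx p (suc r) f) q i j) (α⟨x⟩^p^m m q<N (i , j)) ⟩
      Mon q 0 (i , j) + Mon 0 q (i , j) ∎

    z-x^q : ∀ J i → act p (suc r) a f (z N J) x^q i ≈ δ (toℕ i) q * δ 0 J + δ (toℕ i) 0 * δ q J
    z-x^q J i = begin
      ∑ N (λ j → α p (suc r) a f x^q i j * δ (toℕ j) J)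
        ≈⟨ ∑-cong N (λ j → trans (*-congʳ (α⟨x^q⟩ i j)) (distribʳ _ _ _)) ⟩
      ∑ N (λ j → (δ (toℕ i) q * δ (toℕ j) 0) * δ (toℕ j) J + (δ (toℕ i) 0 * δ (toℕ j) q) * δ (toℕ j) J)
        ≈⟨ trans (∑-+ N _ _) (+-cong (z-t^ (δ (toℕ i) q) 0 (p^>0 (suc r))) (z-t^ (δ (toℕ i) 0) q q<N)) ⟩
      δ (toℕ i) q * δ 0 J + δ (toℕ i) 0 * δ q J ∎
      where
      z-t^ : ∀ A s → s < N → ∑ N (λ j → (A * δ (toℕ j) s) * δ (toℕ j) J) ≈ A * δ s J
      z-t^ A s s<N = begin
        ∑ N (λ j → (A * δ (toℕ j) s) * δ (toℕ j) J)  ≈⟨ ∑-cong N (λ j → trans (*-congʳ (*-comm _ _)) (*-assoc _ _ _)) ⟩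
        ∑ N (λ j → δ (toℕ j) s * (A * δ (toℕ j) J))  ≈⟨ ∑-δ N s s<N _ ⟩
        A * δ (toℕ (fromℕ< s<N)) J                   ≡⟨ ≡.cong (λ x → A * δ x J) (Finₚ.toℕ-fromℕ< s<N) ⟩
        A * δ s J                                     ∎

    q≢0 : q ≢ 0
    q≢0 = ℕₚ.<⇒≢ (p^>0 (suc m)) ∘ ≡.sym

    z₀-x^q : ∀ i → act p (suc r) a f (z N 0) x^q i ≈ x^q i
    z₀-x^q i = begin
      _                                        ≈⟨ z-x^q 0 i ⟩
      δ (toℕ i) q * δ 0 0 + δ (toℕ i) 0 * δ q 0 ≈⟨ +-cong (*-congˡ (δ-≡ 0 0 ≡.refl)) (*-congˡ (δ-≢ q 0 q≢0)) ⟩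
      δ (toℕ i) q * 1# + δ (toℕ i) 0 * 0#       ≈⟨ trans (+-cong (*-identityʳ _) (zeroʳ _)) (+-identityʳ _) ⟩
      δ (toℕ i) q                               ≈⟨ Reduction.x^ K N a q q<N i ⟨
      x^q i                                     ∎

    z_q-x^q : ∀ i → act p (suc r) a f (z N q) x^q i ≈ oneL N i
    z_q-x^q i = begin
      _                                        ≈⟨ z-x^q q i ⟩
      δ (toℕ i) q * δ 0 q + δ (toℕ i) 0 * δ q q
        ≈⟨ +-cong (*-congˡ (δ-≢ 0 q (q≢0 ∘ ≡.sym))) (*-congˡ (δ-≡ q q ≡.refl)) ⟩
      δ (toℕ i) q * 0# + δ (toℕ i) 0 * 1#       ≈⟨ trans (+-cong (zeroʳ _) (*-identityʳ _)) (+-identityˡ _) ⟩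
      oneL N i                                  ∎

    z_j-x^q : ∀ (j : Fin N) → toℕ j ≢ 0 → toℕ j ≢ q → ∀ i → act p (suc r) a f (z N (toℕ j)) x^q i ≈ 0#
    z_j-x^q j j≢0 j≢q i = begin
      _                                                  ≈⟨ z-x^q (toℕ j) i ⟩
      δ (toℕ i) q * δ 0 (toℕ j) + δ (toℕ i) 0 * δ q (toℕ j)
        ≈⟨ +-cong (*-congˡ (δ-≢ 0 _ (j≢0 ∘ ≡.sym))) (*-congˡ (δ-≢ q _ (j≢q ∘ ≡.sym))) ⟩
      δ (toℕ i) q * 0# + δ (toℕ i) 0 * 0#                   ≈⟨ trans (+-cong (zeroʳ _) (zeroʳ _)) (+-identityʳ _) ⟩
      0#                                                    ∎

open import Data.Nat using (_^_)
open import Data.Product using (_×_)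

lemma5p8 : ∀ {c ℓ} (K : Field c ℓ) → let open Field K in let open FieldOps K in
    (p : ℕ) → Prime p → HasChar p →
    (n : ℕ) → 2 ≤ n →
    (f : Carrier) → ¬ (f ≈ 0#) →
    (a : Carrier) → IsFieldL (p ^ n) a →
    (m : ℕ) → 1 ≤ m → m ≤ n ∸ 1 →
      (∀ i → act p n a f (z (p ^ n) 0) (powL (p ^ n) a (xL (p ^ n)) (p ^ m)) i
               ≈ powL (p ^ n) a (xL (p ^ n)) (p ^ m) i)
      × (∀ i → act p n a f (z (p ^ n) (p ^ m)) (powL (p ^ n) a (xL (p ^ n)) (p ^ m)) i
               ≈ oneL (p ^ n) i)
      × (∀ (j : Fin (p ^ n)) → toℕ j ≢ 0 → toℕ j ≢ p ^ m →
           ∀ i → act p n a f (z (p ^ n) (toℕ j)) (powL (p ^ n) a (xL (p ^ n)) (p ^ m)) i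
                 ≈ 0#)
lemma5p8 K p p-prime char (suc r) _ f _ a _ (suc m) _ m≤r =
  z₀-x^q m q<N , z_q-x^q m q<N , z_j-x^q m q<N
  where
  open Coaction K p-prime char r a f
  q<N : p ^ suc m < p ^ suc r
  q<N = ℕₚ.^-monoʳ-< p 1<p (s≤s m≤r)
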